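{- Let $a<b$, let $J=\{s_a,\dots,s_{b-1}\}$, and let $x\in S_n$ be a $4231$-avoiding and $45312$-avoiding permutation with $x(a)>x(a+1)>\dots>x(b)$ such that $[a,b]$ is a strong right-descent interval of $x$. Let $y$ be the minimal-length element of $xW_J$ (obtained from $x$ by sorting the values on positions $[a,b]$ increasingly). Let $l,r\in[a,b]$ be such that a position $p\in[a,b]$ is left-$x$-directed iff $p\in[a,l]$, and right-$x$-directed iff $p\in[r,b]$. Let $J_*\subseteq S$ be the set of $s_i$ such that both $i,i+1$ lie in $[a,a+b-l-1]$ or both lie in $[b-r+a+1,b]$, and let $w_0(J_*)$ be the longest element of $W_{J_*}$. Then $y\,w_0(J_*)$ avoids both $4231$ and $45312$, and every position $p\in[a+b-l,\,b-r+a]$ is $y\,w_0(J_*)$-uncrossed.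
   Context: Permutations act on positions with $(wv)(p)=w(v(p))$; $s_i$ swaps $i,i+1$; $W_K$ is generated by $K$. $\lambda_w(p)$ is the position $q\le p$ maximizing $w(q)$; $\rho_w(p)$ is the position $q\ge p$ minimizing $w(q)$. $[a,b]$ is a strong right-descent interval of $x$ if $x(a)>\dots>x(b)$, $\lambda_x(a)=a$, $\rho_x(b)=b$. For such an interval, a position $p\in[a,b]$ is left-$x$-directed if $x(p)>x(q)$ for all $q<a$, and right-$x$-directed if $x(p)<x(q)$ for all $q>b$. A position $p$ is $w$-uncrossed if $\lambda_w(p)=p=\rho_w(p)$, i.e.\ $w(q)\le w(p)\le w(q')$ for all $q\le p\le q'$. A permutation realizes a pattern if it contains a subsequence order-isomorphic to it, and avoids it otherwise. -}

module Defs where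

open import Data.Nat using (ℕ; zero; suc; _+_; _∸_; _≤_; _<_)
open import Data.Nat.Properties using (_<?_)
open import Data.Fin using (Fin; toℕ)
open import Data.Fin.Permutation using (Permutation′; _⟨$⟩ʳ_; _∘ₚ_; transpose; id)
open import Data.List using (List; length; filter; cartesianProduct; allFin)
open import Data.Product using (_×_; ∃; _,_; proj₁; proj₂)
open import Data.Vec using (Vec; lookup; _∷_; [])
open import Relation.Binary.PropositionalEquality using (_≡_)
open import Relation.Nullary.Decidable using (_×-dec_)
open import Function.Bundles using (_⇔_)

-- Positions are Fin n (0-indexed: paper position p is Fin-position p-1).
-- All position arithmetic below is done on toℕ.

Perm : ℕ → Set
Perm n = Permutation′ n

_at_ : ∀ {n} → Perm n → Fin n → ℕ
w at p = toℕ (w ⟨$⟩ʳ p)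

-- product with the paper's convention (w · v)(p) = w (v p).
-- stdlib's  π₁ ∘ₚ π₂  applies π₁ first, so w · v = v ∘ₚ w.
_·_ : ∀ {n} → Perm n → Perm n → Perm n
w · v = v ∘ₚ w

-- simple transposition s_i (swapping positions i and i+1), given by
-- positions i, j with toℕ j ≡ suc (toℕ i).
-- W_K: subgroup generated by the simple transpositions s_i with K i,
-- given inductively as the closure of the identity under right
-- multiplication by generators (finite group, so this is the generated subgroup).
data InW {n : ℕ} (K : ℕ → Set) : Perm n → Set where
  idW  : InW K id
  step : ∀ {u} (i j : Fin n) → toℕ j ≡ suc (toℕ i) → K (toℕ i) →
         InW K u → InW K (u · transpose i j)

_∈W_ : ∀ {n} → Perm n → (ℕ → Set) → Set
_∈W_ {n} w K = ∃ λ (u : Perm n) → InW K u × (∀ p → w ⟨$⟩ʳ p ≡ u ⟨$⟩ʳ p)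

ℓ : ∀ {n} → Perm n → ℕ
ℓ {n} w = length (filter (λ pq → (toℕ (proj₁ pq) <? toℕ (proj₂ pq))
                               ×-dec (w at proj₂ pq <? w at proj₁ pq))
                         (cartesianProduct (allFin n) (allFin n)))

IsMinCosetRep : ∀ {n} → Perm n → (ℕ → Set) → Perm n → Set
IsMinCosetRep {n} x K y =
  (∃ λ (u : Perm n) → InW K u × (∀ p → y ⟨$⟩ʳ p ≡ (x · u) ⟨$⟩ʳ p))
  × (∀ (u : Perm n) → InW K u → ℓ y ≤ ℓ (x · u))

IsLongest : ∀ {n} → (ℕ → Set) → Perm n → Set
IsLongest {n} K w0 = (w0 ∈W K) × (∀ (u : Perm n) → InW K u → ℓ u ≤ ℓ w0)

-- pattern containment: pattern given as a vector of values (one-line notation)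
Realizes : ∀ {n k} → Perm n → Vec ℕ k → Set
Realizes {n} {k} w π =
  ∃ λ (f : Fin k → Fin n) →
    (∀ s t → toℕ s < toℕ t → toℕ (f s) < toℕ (f t)) ×
    (∀ s t → (lookup π s < lookup π t) ⇔ (w at f s < w at f t))

Avoids : ∀ {n k} → Perm n → Vec ℕ k → Set
Avoids w π = Realizes w π → Data.Empty.⊥
  where import Data.Empty

p4231 : Vec ℕ 4
p4231 = 4 ∷ 2 ∷ 3 ∷ 1 ∷ []

p45312 : Vec ℕ 5
p45312 = 4 ∷ 5 ∷ 3 ∷ 1 ∷ 2 ∷ []

LambdaIs : ∀ {n} → Perm n → Fin n → Fin n → Set
LambdaIs {n} w p q = toℕ q ≤ toℕ p × (∀ (q' : Fin n) → toℕ q' ≤ toℕ p → w at q' ≤ w at q)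

RhoIs : ∀ {n} → Perm n → Fin n → Fin n → Set
RhoIs {n} w p q = toℕ p ≤ toℕ q × (∀ (q' : Fin n) → toℕ p ≤ toℕ q' → w at q ≤ w at q')

StrongRightDescent : ∀ {n} → Perm n → Fin n → Fin n → Set
StrongRightDescent {n} x a b =
  (∀ (p q : Fin n) → toℕ a ≤ toℕ p → toℕ p < toℕ q → toℕ q ≤ toℕ b → x at q < x at p)
  × LambdaIs x a a × RhoIs x b b

LeftDirected : ∀ {n} → Perm n → Fin n → Fin n → Fin n → Set
LeftDirected {n} x a b p = ∀ (q : Fin n) → toℕ q < toℕ a → x at q < x at p

RightDirected : ∀ {n} → Perm n → Fin n → Fin n → Fin n → Set
RightDirected {n} x a b p = ∀ (q : Fin n) → toℕ b < toℕ q → x at p < x at q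

Uncrossed : ∀ {n} → Perm n → Fin n → Set
Uncrossed w p = LambdaIs w p p × RhoIs w p p

Jint : ℕ → ℕ → ℕ → Set
Jint a b i = a ≤ i × suc i ≤ b

Jstar : ℕ → ℕ → ℕ → ℕ → ℕ → Set
Jstar a b l r i = (a ≤ i × suc (suc i) ≤ a + (b ∸ l))
                  Data.Sum.⊎ (suc ((b ∸ r) + a) ≤ i × suc i ≤ b)
  where import Data.Sum

-- Write y = x u with u ∈ W_J.  Exchanging an adjacent descent lowers the length, so minimality
-- makes y increasing on [a,b] and maximality makes w₀ ∈ W_{J*} decreasing on both blocks of J*:
-- u reverses [a,b] and w₀ reverses each block.  Hence z = y w₀ is x with its values
-- on [a,b] rearranged by σ = u w₀, which shifts the left block increasingly onto (l,b], reflects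
-- the middle [a+b-l, b-r+a] onto [r,l] and shifts the right block increasingly onto [a,r).
-- Avoidance of 45312 by x forces r ≤ l+1, so x(σ p) is left-directed unless p lies in the left
-- block and right-directed unless p lies in the right block.  Thus an ascent of z inside [a,b]
-- lies within one block, its top is left-directed and its bottom right-directed.  In an occurrence
-- of 4231 or 45312 in z such an ascent would produce a 312 or 231 inside [a,b] or contradict
-- directedness; an occurrence without one is carried by σ to an occurrence in x.  The middle
-- positions are uncrossed because σ maps them into [r,l].
module Submission where

open import Defs
open import Data.Nat using (ℕ; zero; suc; _+_; _∸_; _≤_; _<_; z≤n; s≤s; _≤?_)
open import Data.Nat.Properties renaming (_≟_ to _≟ℕ_)
open import Data.Fin using (Fin; toℕ; zero; suc; _≟_; fromℕ<; inject₁; #_)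
open import Data.Fin.Properties using (toℕ-injective; toℕ-fromℕ<; toℕ<n; all?; ¬∀⟶∃¬)
open import Data.Nat.Solver using (module +-*-Solver)
open +-*-Solver using (solve; _:+_; con; _:=_)
import Data.Fin.Permutation.Components as PC
open import Data.Fin.Permutation using (_⟨$⟩ʳ_; transpose)
open import Data.List using (List; []; _∷_; _++_; map; length; filter; cartesianProduct; tabulate)
open import Data.List.Properties using (filter-++; length-++)
open import Data.Vec using (Vec; lookup; _∷_; [])
open import Function.Bundles using (_⇔_; mk⇔; Equivalence; Injection)
open import Function.Properties.Inverse using (↔⇒↣)
open import Data.Product using (_×_; ∃; _,_; proj₁; proj₂)
open import Data.Sum using (_⊎_; inj₁; inj₂)
open import Data.Empty using (⊥-elim)
open import Relation.Nullary using (Dec; yes; no; ¬_)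
open import Relation.Nullary.Decidable using (_×-dec_; _⊎-dec_; _→-dec_; from-yes; True; toWitness; decidable-stable)
open import Level using (0ℓ)
open import Relation.Unary using (Pred; Decidable)
open import Relation.Binary.PropositionalEquality
open import Function using (_∘_; id; case_of_)
open import Relation.Binary.Definitions using (Transitive; tri<; tri≈; tri>)
open import Algebra.Properties.CommutativeMonoid.Sum +-0-commutativeMonoid using (sum; sum-permute; sum-cong-≗)

𝟙 : ∀ {a} {A : Set a} → Dec A → ℕ
𝟙 (yes _) = 1
𝟙 (no _)  = 0

𝟙-mono : ∀ {A B : Set} → (A → B) → (d : Dec A) (e : Dec B) → 𝟙 d ≤ 𝟙 e
𝟙-mono f (yes a) (yes b) = ≤-refl
𝟙-mono f (yes a) (no ¬b) = ⊥-elim (¬b (f a))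
𝟙-mono f (no _)  e       = z≤n

𝟙-cong : ∀ {A B : Set} → (A → B) → (B → A) → (d : Dec A) (e : Dec B) → 𝟙 d ≡ 𝟙 e
𝟙-cong f g d e = ≤-antisym (𝟙-mono f d e) (𝟙-mono g e d)

𝟙-no : ∀ {A : Set} → ¬ A → (d : Dec A) → 𝟙 d ≡ 0
𝟙-no ¬a (yes a) = ⊥-elim (¬a a)
𝟙-no ¬a (no _)  = refl

𝟙-yes : ∀ {A : Set} → A → (d : Dec A) → 𝟙 d ≡ 1
𝟙-yes a (yes _)  = refl
𝟙-yes a (no ¬a)  = ⊥-elim (¬a a)

sum-mono-≤ : ∀ {n} (f g : Fin n → ℕ) → (∀ k → f k ≤ g k) → sum f ≤ sum g
sum-mono-≤ {zero}  f g f≤g = ≤-refl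
sum-mono-≤ {suc n} f g f≤g = +-mono-≤ (f≤g zero) (sum-mono-≤ (f ∘ suc) (g ∘ suc) (f≤g ∘ suc))

sum-mono-< : ∀ {n} (f g : Fin n → ℕ) → (∀ k → f k ≤ g k) → ∀ k → f k < g k → sum f < sum g
sum-mono-< {suc n} f g f≤g zero    fk<gk = +-mono-<-≤ fk<gk (sum-mono-≤ (f ∘ suc) (g ∘ suc) (f≤g ∘ suc))
sum-mono-< {suc n} f g f≤g (suc k) fk<gk = +-mono-≤-< (f≤g zero) (sum-mono-< (f ∘ suc) (g ∘ suc) (f≤g ∘ suc) k fk<gk)

module _ {A B : Set} {P : Pred (A × B) 0ℓ} (P? : Decidable P) where

  length-filter-map : ∀ a (ys : List B) →
    length (filter P? (map (a ,_) ys)) ≡ length (filter (λ b → P? (a , b)) ys)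
  length-filter-map a []       = refl
  length-filter-map a (y ∷ ys) with P? (a , y)
  ... | yes _ = cong suc (length-filter-map a ys)
  ... | no _  = length-filter-map a ys

  length-filter-tabulate : ∀ {n} (g : Fin n → B) a →
    length (filter (λ b → P? (a , b)) (tabulate g)) ≡ sum (λ j → 𝟙 (P? (a , g j)))
  length-filter-tabulate {zero}  g a = refl
  length-filter-tabulate {suc n} g a with P? (a , g zero)
  ... | yes _ = cong suc (length-filter-tabulate (g ∘ suc) a)
  ... | no _  = length-filter-tabulate (g ∘ suc) a

  length-filter-cartesianProduct : ∀ {m n} (f : Fin m → A) (g : Fin n → B) →
    length (filter P? (cartesianProduct (tabulate f) (tabulate g)))
      ≡ sum (λ i → sum (λ j → 𝟙 (P? (f i , g j))))
  length-filter-cartesianProduct {zero}  f g = refl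
  length-filter-cartesianProduct {suc m} f g = begin
    length (filter P? (map (f zero ,_) (tabulate g) ++ rest))
      ≡⟨ cong length (filter-++ P? (map (f zero ,_) (tabulate g)) rest) ⟩
    length (filter P? (map (f zero ,_) (tabulate g)) ++ filter P? rest)
      ≡⟨ length-++ (filter P? (map (f zero ,_) (tabulate g))) ⟩
    length (filter P? (map (f zero ,_) (tabulate g))) + length (filter P? rest)
      ≡⟨ cong₂ _+_ (trans (length-filter-map (f zero) (tabulate g)) (length-filter-tabulate g (f zero)))
                   (length-filter-cartesianProduct (f ∘ suc) g) ⟩
    sum (λ j → 𝟙 (P? (f zero , g j))) + sum (λ i → sum (λ j → 𝟙 (P? (f (suc i) , g j)))) ∎
    where
    open ≡-Reasoning
    rest = cartesianProduct (tabulate (f ∘ suc)) (tabulate g)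

inversion? : ∀ {n} (w : Perm n) (p q : Fin n) → Dec (toℕ p < toℕ q × w at q < w at p)
inversion? w p q = (toℕ p <? toℕ q) ×-dec (w at q <? w at p)

ℓ-as-sum : ∀ {n} (w : Perm n) → ℓ w ≡ sum (λ p → sum (λ q → 𝟙 (inversion? w p q)))
ℓ-as-sum w = length-filter-cartesianProduct (λ pq → inversion? w (proj₁ pq) (proj₂ pq)) id id

ℓ-cong : ∀ {n} (w v : Perm n) → (∀ p → w ⟨$⟩ʳ p ≡ v ⟨$⟩ʳ p) → ℓ w ≡ ℓ v
ℓ-cong w v w≗v = begin
  ℓ w                                                    ≡⟨ ℓ-as-sum w ⟩
  sum (λ p → sum (λ q → 𝟙 (inversion? w p q)))           ≡⟨ sum-cong-≗ (λ p → sum-cong-≗ (λ q → same p q)) ⟩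
  sum (λ p → sum (λ q → 𝟙 (inversion? v p q)))           ≡⟨ sym (ℓ-as-sum v) ⟩
  ℓ v                                                    ∎
  where
  open ≡-Reasoning
  at-eq : ∀ p → w at p ≡ v at p
  at-eq p = cong toℕ (w≗v p)
  same : ∀ p q → 𝟙 (inversion? w p q) ≡ 𝟙 (inversion? v p q)
  same p q = 𝟙-cong (λ (p<q , wq<wp) → p<q , subst₂ _<_ (at-eq q) (at-eq p) wq<wp)
                    (λ (p<q , vq<vp) → p<q , subst₂ _<_ (sym (at-eq q)) (sym (at-eq p)) vq<vp) _ _

at-injective : ∀ {n} (w : Perm n) {p q : Fin n} → w at p ≡ w at q → p ≡ q
at-injective w wp≡wq = Injection.injective (↔⇒↣ w) (toℕ-injective wp≡wq)

at-≤⇒< : ∀ {n} (w : Perm n) {p q : Fin n} → toℕ p ≢ toℕ q → w at p ≤ w at q → w at p < w at q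
at-≤⇒< w p≢q wp≤wq = ≤∧≢⇒< wp≤wq (λ wp≡wq → p≢q (cong toℕ (at-injective w wp≡wq)))

∃-violation : ∀ {n} {P Q : Fin n → Set} → Decidable P → Decidable Q →
  ¬ (∀ q → P q → Q q) → ∃ λ q → P q × ¬ Q q
∃-violation {n} P? Q? ¬∀ with ¬∀⟶∃¬ n _ (λ q → P? q →-dec Q? q) ¬∀
... | q , ¬[Pq→Qq] = q , decidable-stable (P? q) (λ ¬Pq → ¬[Pq→Qq] (⊥-elim ∘ ¬Pq)) , λ Qq → ¬[Pq→Qq] (λ _ → Qq)

data Transposes {n} (i j : Fin n) : Fin n → Fin n → Set where
  at-i  : Transposes i j i j
  at-j  : Transposes i j j i
  other : ∀ {k} → k ≢ i → k ≢ j → Transposes i j k k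

transposes : ∀ {n} (i j k : Fin n) → Transposes i j k (PC.transpose i j k)
transposes i j k with k ≟ i
... | yes refl = at-i
... | no k≢i with k ≟ j
...   | yes refl = at-j
...   | no k≢j   = other k≢i k≢j

module AdjacentTransposition {n} (i j : Fin n) (adj : toℕ j ≡ suc (toℕ i)) where

  τ : Fin n → Fin n
  τ = PC.transpose i j

  i<j : toℕ i < toℕ j
  i<j = ≤-reflexive (sym adj)

  i≢j : i ≢ j
  i≢j refl = <-irrefl refl i<j

  τ-i : τ i ≡ j
  τ-i with PC.transpose i j i | transposes i j i
  ... | _ | at-i        = refl
  ... | _ | at-j        = refl
  ... | _ | other i≢i _ = ⊥-elim (i≢i refl)

  τ-j : τ j ≡ i
  τ-j with PC.transpose i j j | transposes i j j
  ... | _ | at-i        = ⊥-elim (i≢j refl)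
  ... | _ | at-j        = refl
  ... | _ | other _ j≢j = ⊥-elim (j≢j refl)

  τ-involutive : ∀ k → τ (τ k) ≡ k
  τ-involutive k with PC.transpose i j k | transposes i j k
  ... | _ | at-i          = τ-j
  ... | _ | at-j          = τ-i
  ... | _ | other k≢i k≢j with PC.transpose i j k | transposes i j k
  ...   | _ | at-i        = ⊥-elim (k≢i refl)
  ...   | _ | at-j        = ⊥-elim (k≢j refl)
  ...   | _ | other _ _   = refl

  τ-reverses-only-i-j : ∀ p q → toℕ q < toℕ p → toℕ (τ p) < toℕ (τ q) → q ≡ i × p ≡ j
  τ-reverses-only-i-j p q q<p τp<τq with PC.transpose i j p | transposes i j p | PC.transpose i j q | transposes i j q
  ... | _ | at-i        | _ | at-i        = ⊥-elim (<-irrefl refl q<p)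
  ... | _ | at-i        | _ | at-j        = ⊥-elim (<-asym q<p i<j)
  ... | _ | at-i        | _ | other _ _   = ⊥-elim (<-asym q<p (<-trans i<j τp<τq))
  ... | _ | at-j        | _ | at-i        = refl , refl
  ... | _ | at-j        | _ | at-j        = ⊥-elim (<-irrefl refl q<p)
  ... | _ | at-j        | _ | other _ _   = ⊥-elim (<⇒≱ τp<τq (≤-pred (subst (toℕ q <_) adj q<p)))
  ... | _ | other _ _   | _ | at-i        = ⊥-elim (<⇒≱ q<p (≤-pred (subst (toℕ p <_) adj τp<τq)))
  ... | _ | other _ _   | _ | at-j        = ⊥-elim (<-asym (<-trans τp<τq i<j) q<p)
  ... | _ | other _ _   | _ | other _ _   = ⊥-elim (<-asym τp<τq q<p)

ℓ-swap-descent : ∀ {n} (w : Perm n) (i j : Fin n) → toℕ j ≡ suc (toℕ i) →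
  w at j < w at i → ℓ (w · transpose i j) < ℓ w
ℓ-swap-descent w i j adj wj<wi = begin-strict
  ℓ (w · transpose i j)                            ≡⟨ ℓ-as-sum (w · transpose i j) ⟩
  sum (λ p → sum (λ q → inv′ p q))                 ≡⟨ sum-permute (λ p → sum (λ q → inv′ p q)) (transpose i j) ⟩
  sum (λ p → sum (λ q → inv′ (τ p) q))
    ≡⟨ sum-cong-≗ (λ p → sum-permute (λ q → inv′ (τ p) q) (transpose i j)) ⟩
  sum (λ p → sum (λ q → inv′ (τ p) (τ q)))         <⟨ sum-mono-< _ _ (λ p → sum-mono-≤ _ _ (fewer p)) i
                                                        (sum-mono-< _ _ (fewer i) j fewer-at-i-j) ⟩
  sum (λ p → sum (λ q → 𝟙 (inversion? w p q)))     ≡⟨ sym (ℓ-as-sum w) ⟩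
  ℓ w                                              ∎
  where
  open ≤-Reasoning
  open AdjacentTransposition i j adj
  inv′ : Fin _ → Fin _ → ℕ
  inv′ p q = 𝟙 (inversion? (w · transpose i j) p q)
  fewer : ∀ p q → inv′ (τ p) (τ q) ≤ 𝟙 (inversion? w p q)
  fewer p q = 𝟙-mono still-inversion _ _
    where
    still-inversion : toℕ (τ p) < toℕ (τ q) × w at τ (τ q) < w at τ (τ p) → toℕ p < toℕ q × w at q < w at p
    still-inversion (τp<τq , v) with subst₂ (λ s t → w at s < w at t) (τ-involutive q) (τ-involutive p) v
    ... | wq<wp with <-cmp (toℕ p) (toℕ q)
    ...   | tri< p<q _ _ = p<q , wq<wp
    ...   | tri≈ _ p≡q _ rewrite toℕ-injective p≡q = ⊥-elim (<-irrefl refl τp<τq)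
    ...   | tri> _ _ q<p with τ-reverses-only-i-j p q q<p τp<τq
    ...     | refl , refl = ⊥-elim (<-asym wj<wi wq<wp)
  fewer-at-i-j : inv′ (τ i) (τ j) < 𝟙 (inversion? w i j)
  fewer-at-i-j = subst₂ _<_ (sym (𝟙-no not-inversion _)) (sym (𝟙-yes (i<j , wj<wi) _)) (s≤s z≤n)
    where
    not-inversion : ¬ (toℕ (τ i) < toℕ (τ j) × w at τ (τ j) < w at τ (τ i))
    not-inversion (τi<τj , _) rewrite τ-i | τ-j = <-asym τi<τj i<j

InW-preserves : ∀ {n} {K : ℕ → Set} (R : ℕ → Set) →
  (∀ i → K i → R i → R (suc i)) → (∀ i → K i → R (suc i) → R i) →
  ∀ {u : Perm n} → InW K u → ∀ p → R (toℕ p) → R (u at p)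
InW-preserves R up down idW p Rp = Rp
InW-preserves R up down (step i j adj Ki u∈W) p Rp with PC.transpose i j p | transposes i j p
... | _ | at-i      = InW-preserves R up down u∈W j (subst R (sym adj) (up _ Ki Rp))
... | _ | at-j      = InW-preserves R up down u∈W i (down _ Ki (subst R adj Rp))
... | _ | other _ _ = InW-preserves R up down u∈W p Rp

InW-fixes : ∀ {n} {K : ℕ → Set} (R : ℕ → Set) → (∀ i → K i → R i × R (suc i)) →
  ∀ {u : Perm n} → InW K u → ∀ p → ¬ R (toℕ p) → u ⟨$⟩ʳ p ≡ p
InW-fixes R supp idW p ¬Rp = refl
InW-fixes R supp (step i j adj Ki u∈W) p ¬Rp with PC.transpose i j p | transposes i j p
... | _ | at-i      = ⊥-elim (¬Rp (proj₁ (supp _ Ki)))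
... | _ | at-j      = ⊥-elim (¬Rp (subst R (sym adj) (proj₂ (supp _ Ki))))
... | _ | other _ _ = InW-fixes R supp u∈W p ¬Rp

·-transpose-involutive : ∀ {n} (w : Perm n) (i j : Fin n) → toℕ j ≡ suc (toℕ i) →
  ∀ p → ((w · transpose i j) · transpose i j) ⟨$⟩ʳ p ≡ w ⟨$⟩ʳ p
·-transpose-involutive w i j adj p = cong (w ⟨$⟩ʳ_) (AdjacentTransposition.τ-involutive i j adj p)

minCosetRep-ascent : ∀ {n} {K : ℕ → Set} {x y : Perm n} → IsMinCosetRep x K y →
  ∀ i j → toℕ j ≡ suc (toℕ i) → K (toℕ i) → y at i < y at j
minCosetRep-ascent {x = x} {y} ((u , u∈W , y≗xu) , minimal) i j adj Ki with <-cmp (y at i) (y at j)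
... | tri< yi<yj _ _ = yi<yj
... | tri≈ _ yi≡yj _ = ⊥-elim (AdjacentTransposition.i≢j i j adj (at-injective y yi≡yj))
... | tri> _ _ yj<yi = ⊥-elim (<-irrefl refl (≤-<-trans ℓy≤ℓyt (ℓ-swap-descent y i j adj yj<yi)))
  where
  t = transpose i j
  ℓy≤ℓyt : ℓ y ≤ ℓ (y · t)
  ℓy≤ℓyt = ≤-trans (minimal (u · t) (step i j adj Ki u∈W))
                   (≤-reflexive (ℓ-cong (x · (u · t)) (y · t) (λ p → sym (y≗xu (t ⟨$⟩ʳ p)))))

longest-descent : ∀ {n} {K : ℕ → Set} {w₀ : Perm n} → IsLongest K w₀ →
  ∀ i j → toℕ j ≡ suc (toℕ i) → K (toℕ i) → w₀ at j < w₀ at i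
longest-descent {w₀ = w₀} ((v , v∈W , w₀≗v) , longest) i j adj Ki with <-cmp (v at i) (v at j)
... | tri> _ _ vj<vi = subst₂ _<_ (sym (w₀-at j)) (sym (w₀-at i)) vj<vi
  where w₀-at = λ p → cong toℕ (w₀≗v p)
... | tri≈ _ vi≡vj _ = ⊥-elim (AdjacentTransposition.i≢j i j adj (at-injective v vi≡vj))
... | tri< vi<vj _ _ =
  ⊥-elim (<-irrefl refl (<-≤-trans ℓv<ℓvt (≤-trans ℓvt≤ℓw₀ (≤-reflexive (ℓ-cong w₀ v w₀≗v)))))
  where
  open AdjacentTransposition i j adj
  t = transpose i j
  vt-descent : (v · t) at j < (v · t) at i
  vt-descent = subst₂ _<_ (cong (v at_) (sym τ-j)) (cong (v at_) (sym τ-i)) vi<vj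
  ℓv<ℓvt : ℓ v < ℓ (v · t)
  ℓv<ℓvt = subst (_< ℓ (v · t)) (ℓ-cong ((v · t) · t) v (·-transpose-involutive v i j adj))
                 (ℓ-swap-descent (v · t) i j adj vt-descent)
  ℓvt≤ℓw₀ : ℓ (v · t) ≤ ℓ w₀
  ℓvt≤ℓw₀ = longest (v · t) (step i j adj Ki v∈W)

module DecreasingSelfMap {n} (lo hi : ℕ) (hi≤n : hi ≤ n) (g : Fin n → ℕ)
  (maps-into : ∀ k → lo ≤ toℕ k → toℕ k < hi → lo ≤ g k × g k < hi)
  (decreasing : ∀ i j → toℕ j ≡ suc (toℕ i) → lo ≤ toℕ i → toℕ j < hi → g j < g i) where

  private
    position : ∀ m → m < hi → Fin n
    position m m<hi = fromℕ< (<-≤-trans m<hi hi≤n)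

    toℕ-position : ∀ m (m<hi : m < hi) → toℕ (position m m<hi) ≡ m
    toℕ-position m m<hi = toℕ-fromℕ< _

  bounded-below : ∀ d k → lo ≤ toℕ k → toℕ k + suc d ≡ hi → lo + d ≤ g k
  bounded-below zero k lo≤k k+1≡hi = begin
    lo + 0  ≡⟨ +-identityʳ lo ⟩
    lo      ≤⟨ proj₁ (maps-into k lo≤k (subst (toℕ k <_) k+1≡hi (≤-reflexive (+-comm 1 (toℕ k))))) ⟩
    g k     ∎
    where open ≤-Reasoning
  bounded-below (suc d) k lo≤k k+d+2≡hi = begin
    lo + suc d   ≡⟨ +-suc lo d ⟩
    suc (lo + d) ≤⟨ s≤s (bounded-below d k′ lo≤k′ k′+d+1≡hi) ⟩
    suc (g k′)   ≤⟨ decreasing k k′ k′≡k+1 lo≤k (subst (_< hi) (sym k′≡k+1) k+1<hi) ⟩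
    g k          ∎
    where
    open ≤-Reasoning
    k+1<hi : suc (toℕ k) < hi
    k+1<hi = subst (suc (toℕ k) <_) k+d+2≡hi (≤-trans (s≤s (s≤s (m≤m+n (toℕ k) d)))
               (≤-reflexive (sym (trans (+-suc (toℕ k) (suc d)) (cong suc (+-suc (toℕ k) d))))))
    k′ = position (suc (toℕ k)) k+1<hi
    k′≡k+1 = toℕ-position (suc (toℕ k)) k+1<hi
    lo≤k′ : lo ≤ toℕ k′
    lo≤k′ = ≤-trans lo≤k (≤-trans (n≤1+n _) (≤-reflexive (sym k′≡k+1)))
    k′+d+1≡hi : toℕ k′ + suc d ≡ hi
    k′+d+1≡hi = trans (cong (_+ suc d) k′≡k+1) (trans (sym (+-suc (toℕ k) (suc d))) k+d+2≡hi)

  bounded-above : ∀ d k → toℕ k < hi → lo + d ≡ toℕ k → g k + d < hi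
  bounded-above zero k k<hi lo≡k = subst (_< hi) (sym (+-identityʳ (g k)))
    (proj₂ (maps-into k (subst (lo ≤_) lo≡k (m≤m+n lo 0)) k<hi))
  bounded-above (suc d) k k<hi lo+d+1≡k = begin-strict
    g k + suc d    ≡⟨ +-suc (g k) d ⟩
    suc (g k) + d  ≤⟨ +-monoˡ-≤ d (decreasing k″ k k≡k″+1 lo≤k″ k<hi) ⟩
    g k″ + d       <⟨ bounded-above d k″ (<-trans (≤-reflexive (sym k≡k″+1)) k<hi) (sym k″≡lo+d) ⟩
    hi             ∎
    where
    open ≤-Reasoning
    lo+d<hi : lo + d < hi
    lo+d<hi = <-trans (subst (lo + d <_) lo+d+1≡k (≤-reflexive (sym (+-suc lo d)))) k<hi
    k″ = position (lo + d) lo+d<hi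
    k″≡lo+d = toℕ-position (lo + d) lo+d<hi
    lo≤k″ : lo ≤ toℕ k″
    lo≤k″ = ≤-trans (m≤m+n lo d) (≤-reflexive (sym k″≡lo+d))
    k≡k″+1 : toℕ k ≡ suc (toℕ k″)
    k≡k″+1 = trans (sym lo+d+1≡k) (trans (+-suc lo d) (cong suc (sym k″≡lo+d)))

  reversal : ∀ k → lo ≤ toℕ k → toℕ k < hi → g k + suc (toℕ k) ≡ lo + hi
  reversal k lo≤k k<hi = ≤-antisym upper lower
    where
    d = hi ∸ suc (toℕ k)
    e = toℕ k ∸ lo
    k+d+1≡hi : toℕ k + suc d ≡ hi
    k+d+1≡hi = trans (+-suc (toℕ k) d) (m+[n∸m]≡n k<hi)
    lo+e≡k : lo + e ≡ toℕ k
    lo+e≡k = m+[n∸m]≡n lo≤k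
    lower : lo + hi ≤ g k + suc (toℕ k)
    lower = begin
      lo + hi                 ≡⟨ cong (lo +_) (sym k+d+1≡hi) ⟩
      lo + (toℕ k + suc d)    ≡⟨ solve 3 (λ l k d → l :+ (k :+ (con 1 :+ d)) := (con 1 :+ (l :+ d)) :+ k) refl lo (toℕ k) d ⟩
      suc (lo + d) + toℕ k    ≤⟨ +-monoˡ-≤ (toℕ k) (s≤s (bounded-below d k lo≤k k+d+1≡hi)) ⟩
      suc (g k) + toℕ k       ≡⟨ sym (+-suc (g k) (toℕ k)) ⟩
      g k + suc (toℕ k)       ∎
      where open ≤-Reasoning
    upper : g k + suc (toℕ k) ≤ lo + hi
    upper = begin
      g k + suc (toℕ k)       ≡⟨ cong (λ m → g k + suc m) (sym lo+e≡k) ⟩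
      g k + suc (lo + e)      ≡⟨ solve 3 (λ g l e → g :+ (con 1 :+ (l :+ e)) := (con 1 :+ (g :+ e)) :+ l) refl (g k) lo e ⟩
      suc (g k + e) + lo      ≤⟨ +-monoˡ-≤ lo (bounded-above e k k<hi lo+e≡k) ⟩
      hi + lo                 ≡⟨ +-comm hi lo ⟩
      lo + hi                 ∎
      where open ≤-Reasoning

increasing-by-steps : ∀ {k ℓ′} (R : Fin (suc k) → Fin (suc k) → Set ℓ′) → Transitive R →
  (∀ (i : Fin k) → R (inject₁ i) (suc i)) → ∀ s t → toℕ s < toℕ t → R s t
increasing-by-steps {suc k} R R-trans next zero    (suc zero)    _   = next zero
increasing-by-steps {suc k} R R-trans next zero    (suc (suc t)) _   =
  R-trans (next zero) (increasing-by-steps (λ s t → R (suc s) (suc t)) R-trans (next ∘ suc) zero (suc t) (s≤s z≤n))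
increasing-by-steps {suc k} R R-trans next (suc s) (suc t)       s<t =
  increasing-by-steps (λ s t → R (suc s) (suc t)) R-trans (next ∘ suc) s t (≤-pred s<t)

realizes-by-chains : ∀ {n k} (w : Perm n) (π : Vec ℕ (suc k)) (rank order : Fin (suc k) → Fin (suc k)) →
  (∀ s → order (rank s) ≡ s) →
  (∀ s t → lookup π s < lookup π t → toℕ (rank s) < toℕ (rank t)) →
  (∀ s t → lookup π s ≡ lookup π t → s ≡ t) →
  (f : Fin (suc k) → Fin n) →
  (∀ i → toℕ (f (inject₁ i)) < toℕ (f (suc i))) →
  (∀ i → w at f (order (inject₁ i)) < w at f (order (suc i))) →
  Realizes w π
realizes-by-chains w π rank order order∘rank rank-mono π-injective f f-steps w-steps =
  f , increasing-by-steps (λ s t → toℕ (f s) < toℕ (f t)) <-trans f-steps , λ s t → mk⇔ (forward s t) (backward s t)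
  where
  forward : ∀ s t → lookup π s < lookup π t → w at f s < w at f t
  forward s t πs<πt = subst₂ (λ s′ t′ → w at f s′ < w at f t′) (order∘rank s) (order∘rank t)
    (increasing-by-steps (λ i j → w at f (order i) < w at f (order j)) <-trans w-steps (rank s) (rank t) (rank-mono s t πs<πt))
  backward : ∀ s t → w at f s < w at f t → lookup π s < lookup π t
  backward s t ws<wt with <-cmp (lookup π s) (lookup π t)
  ... | tri< πs<πt _ _ = πs<πt
  ... | tri≈ _ πs≡πt _ rewrite π-injective s t πs≡πt = ⊥-elim (<-irrefl refl ws<wt)
  ... | tri> _ _ πt<πs = ⊥-elim (<-asym ws<wt (forward t s πt<πs))

-- 45312 is an involution, so listing its positions by increasing value gives its ranks again.
ranks-45312 : Fin 5 → Fin 5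
ranks-45312 = lookup (# 3 ∷ # 4 ∷ # 2 ∷ # 0 ∷ # 1 ∷ [])

realizes-45312 : ∀ {n} (w : Perm n) (q₀ q₁ q₂ q₃ q₄ : Fin n) →
  toℕ q₀ < toℕ q₁ → toℕ q₁ < toℕ q₂ → toℕ q₂ < toℕ q₃ → toℕ q₃ < toℕ q₄ →
  w at q₃ < w at q₄ → w at q₄ < w at q₂ → w at q₂ < w at q₀ → w at q₀ < w at q₁ →
  Realizes w p45312
realizes-45312 w q₀ q₁ q₂ q₃ q₄ q₀<q₁ q₁<q₂ q₂<q₃ q₃<q₄ w₃<w₄ w₄<w₂ w₂<w₀ w₀<w₁ =
  realizes-by-chains w p45312 ranks-45312 ranks-45312
    (from-yes (all? λ s → ranks-45312 (ranks-45312 s) ≟ s))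
    (from-yes (all? λ s → all? λ t → (lookup p45312 s <? lookup p45312 t) →-dec
                                      (toℕ (ranks-45312 s) <? toℕ (ranks-45312 t))))
    (from-yes (all? λ s → all? λ t → (lookup p45312 s ≟ℕ lookup p45312 t) →-dec (s ≟ t)))
    f positions values
  where
  f : Fin 5 → Fin _
  f = lookup (q₀ ∷ q₁ ∷ q₂ ∷ q₃ ∷ q₄ ∷ [])
  positions : ∀ i → toℕ (f (inject₁ i)) < toℕ (f (suc i))
  positions zero                   = q₀<q₁
  positions (suc zero)             = q₁<q₂
  positions (suc (suc zero))       = q₂<q₃
  positions (suc (suc (suc zero))) = q₃<q₄
  values : ∀ i → w at f (ranks-45312 (inject₁ i)) < w at f (ranks-45312 (suc i))
  values zero                   = w₃<w₄
  values (suc zero)             = w₄<w₂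
  values (suc (suc zero))       = w₂<w₀
  values (suc (suc (suc zero))) = w₀<w₁

ascents-of-4231 : ∀ (s t : Fin 4) → toℕ s < toℕ t → lookup p4231 s < lookup p4231 t →
  s ≡ # 1 × t ≡ # 2
ascents-of-4231 = from-yes (all? λ s → all? λ t →
  (toℕ s <? toℕ t) →-dec ((lookup p4231 s <? lookup p4231 t) →-dec ((s ≟ # 1) ×-dec (t ≟ # 2))))

ascents-of-45312 : ∀ (s t : Fin 5) → toℕ s < toℕ t → lookup p45312 s < lookup p45312 t →
  (s ≡ # 0 × t ≡ # 1) ⊎ (s ≡ # 3 × t ≡ # 4)
ascents-of-45312 = from-yes (all? λ s → all? λ t →
  (toℕ s <? toℕ t) →-dec ((lookup p45312 s <? lookup p45312 t) →-dec
    (((s ≟ # 0) ×-dec (t ≟ # 1)) ⊎-dec ((s ≟ # 3) ×-dec (t ≟ # 4)))))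

InInterval : ℕ → ℕ → ℕ → Set
InInterval a b k = a ≤ k × k ≤ b

∉-left : ∀ {a b k} → k < a → ¬ InInterval a b k
∉-left k<a (a≤k , _) = <⇒≱ k<a a≤k

∉-right : ∀ {a b k} → b < k → ¬ InInterval a b k
∉-right b<k (_ , k≤b) = <⇒≱ b<k k≤b

DecreasingOn : ∀ {n} → Perm n → ℕ → ℕ → Set
DecreasingOn {n} x a b = ∀ (p q : Fin n) → a ≤ toℕ p → toℕ p < toℕ q → toℕ q ≤ b → x at q < x at p

DecreasingOn-reflects-< : ∀ {n} {x : Perm n} {a b} → DecreasingOn x a b →
  ∀ p q → a ≤ toℕ p → toℕ p ≤ b → a ≤ toℕ q → toℕ q ≤ b → x at p < x at q → toℕ q < toℕ p
DecreasingOn-reflects-< {x = x} x-decreasing p q a≤p p≤b a≤q q≤b xp<xq with <-cmp (toℕ p) (toℕ q)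
... | tri< p<q _ _ = ⊥-elim (<-asym xp<xq (x-decreasing p q a≤p p<q q≤b))
... | tri≈ _ p≡q _ = ⊥-elim (<-irrefl (cong (x at_) (toℕ-injective p≡q)) xp<xq)
... | tri> _ _ q<p = q<p

NoAscentWithin : ∀ {n k} → Perm n → ℕ → ℕ → (Fin k → Fin n) → Set
NoAscentWithin z a b f = ∀ s t → toℕ s < toℕ t → a ≤ toℕ (f s) → toℕ (f t) ≤ b → ¬ (z at f s < z at f t)

module Rearrangement {n} (x z : Perm n) (σ : Fin n → Fin n) (a b : ℕ)
  (z≡x∘σ : ∀ p → z at p ≡ x at σ p)
  (σ-fixes : ∀ p → ¬ InInterval a b (toℕ p) → σ p ≡ p)
  (σ-maps-into : ∀ p → a ≤ toℕ p → toℕ p ≤ b → a ≤ toℕ (σ p) × toℕ (σ p) ≤ b)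
  (x-decreasing : DecreasingOn x a b) where

  σ-preserves-non-ascents : ∀ p q → toℕ p < toℕ q → (a ≤ toℕ p → toℕ q ≤ b → ¬ (z at p < z at q)) →
    toℕ (σ p) < toℕ (σ q)
  σ-preserves-non-ascents p q p<q no-ascent with toℕ p <? a | b <? toℕ q
  ... | yes p<a | yes b<q rewrite σ-fixes p (∉-left p<a) | σ-fixes q (∉-right b<q) = p<q
  ... | yes p<a | no q≯b with toℕ q <? a
  ...   | yes q<a rewrite σ-fixes p (∉-left p<a) | σ-fixes q (∉-left q<a) = p<q
  ...   | no q≮a rewrite σ-fixes p (∉-left p<a) = <-≤-trans p<a (proj₁ (σ-maps-into q (≮⇒≥ q≮a) (≮⇒≥ q≯b)))
  σ-preserves-non-ascents p q p<q no-ascent | no p≮a | yes b<q with b <? toℕ p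
  ...   | yes b<p rewrite σ-fixes p (∉-right b<p) | σ-fixes q (∉-right b<q) = p<q
  ...   | no p≯b rewrite σ-fixes q (∉-right b<q) = ≤-<-trans (proj₂ (σ-maps-into p (≮⇒≥ p≮a) (≮⇒≥ p≯b))) b<q
  σ-preserves-non-ascents p q p<q no-ascent | no p≮a | no q≯b =
    DecreasingOn-reflects-< {x = x} x-decreasing (σ q) (σ p) (proj₁ σq∈) (proj₂ σq∈) (proj₁ σp∈) (proj₂ σp∈)
      (subst₂ _<_ (z≡x∘σ q) (z≡x∘σ p) zq<zp)
    where
    a≤p = ≮⇒≥ p≮a
    q≤b = ≮⇒≥ q≯b
    σp∈ = σ-maps-into p a≤p (≤-trans (<⇒≤ p<q) q≤b)
    σq∈ = σ-maps-into q (≤-trans a≤p (<⇒≤ p<q)) q≤b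
    zq<zp : z at q < z at p
    zq<zp = at-≤⇒< z (≢-sym (<⇒≢ p<q)) (≮⇒≥ (no-ascent a≤p q≤b))

  realizes-transfer : ∀ {k} {π : Vec ℕ k} (occ : Realizes z π) → NoAscentWithin z a b (proj₁ occ) → Realizes x π
  realizes-transfer (f , f-increasing , same-order) no-ascent =
    σ ∘ f ,
    (λ s t s<t → σ-preserves-non-ascents (f s) (f t) (f-increasing s t s<t) (no-ascent s t s<t)) ,
    λ s t → mk⇔ (λ πs<πt → subst₂ _<_ (z≡x∘σ (f s)) (z≡x∘σ (f t)) (Equivalence.to (same-order s t) πs<πt))
                (λ xs<xt → Equivalence.from (same-order s t) (subst₂ _<_ (sym (z≡x∘σ (f s))) (sym (z≡x∘σ (f t))) xs<xt))

<-decide : ∀ {m n} {m<n : True (m <? n)} → m < n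
<-decide {m<n = m<n} = toWitness m<n

module OccurrencesAcrossInterval {n} (z : Perm n) (a b : ℕ)
  (ascent-top-above-left : ∀ e e′ → a ≤ toℕ e → toℕ e < toℕ e′ → toℕ e′ ≤ b → z at e < z at e′ →
    ∀ q → toℕ q < a → z at q < z at e′)
  (ascent-bottom-below-right : ∀ e e′ → a ≤ toℕ e → toℕ e < toℕ e′ → toℕ e′ ≤ b → z at e < z at e′ →
    ∀ q → b < toℕ q → z at e < z at q)
  (no-312-within : ∀ e₁ e₂ e₃ → a ≤ toℕ e₁ → toℕ e₁ < toℕ e₂ → toℕ e₂ < toℕ e₃ → toℕ e₃ ≤ b →
    z at e₂ < z at e₃ → ¬ (z at e₃ < z at e₁))
  (no-231-within : ∀ e₁ e₂ e₃ → a ≤ toℕ e₁ → toℕ e₁ < toℕ e₂ → toℕ e₂ < toℕ e₃ → toℕ e₃ ≤ b →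
    z at e₃ < z at e₁ → ¬ (z at e₁ < z at e₂)) where

  4231-no-ascent-within : (occ : Realizes z p4231) → NoAscentWithin z a b (proj₁ occ)
  4231-no-ascent-within (f , f-increasing , same-order) s t s<t a≤f₁ f₂≤b z₁<z₂
    with ascents-of-4231 s t s<t (Equivalence.from (same-order s t) z₁<z₂)
  ... | refl , refl with toℕ (f (# 0)) <? a
  ...   | yes f₀<a = <-asym z₂<z₀
          (ascent-top-above-left (f (# 1)) (f (# 2)) a≤f₁ (f-increasing _ _ <-decide) f₂≤b z₁<z₂ (f (# 0)) f₀<a)
    where z₂<z₀ = Equivalence.to (same-order (# 2) (# 0)) <-decide
  ...   | no f₀≮a = no-312-within (f (# 0)) (f (# 1)) (f (# 2)) (≮⇒≥ f₀≮a)
          (f-increasing _ _ <-decide) (f-increasing _ _ <-decide) f₂≤b z₁<z₂ z₂<z₀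
    where z₂<z₀ = Equivalence.to (same-order (# 2) (# 0)) <-decide

  45312-no-ascent-within : (occ : Realizes z p45312) → NoAscentWithin z a b (proj₁ occ)
  45312-no-ascent-within (f , f-increasing , same-order) s t s<t a≤fs ft≤b zs<zt
    with ascents-of-45312 s t s<t (Equivalence.from (same-order s t) zs<zt)
  ... | inj₁ (refl , refl) with b <? toℕ (f (# 2))
  ...   | yes b<f₂ = <-asym z₂<z₀
          (ascent-bottom-below-right (f (# 0)) (f (# 1)) a≤fs (f-increasing _ _ <-decide) ft≤b zs<zt (f (# 2)) b<f₂)
    where z₂<z₀ = Equivalence.to (same-order (# 2) (# 0)) <-decide
  ...   | no b≮f₂ = no-231-within (f (# 0)) (f (# 1)) (f (# 2)) a≤fs
          (f-increasing _ _ <-decide) (f-increasing _ _ <-decide) (≮⇒≥ b≮f₂) z₂<z₀ zs<zt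
    where z₂<z₀ = Equivalence.to (same-order (# 2) (# 0)) <-decide
  45312-no-ascent-within (f , f-increasing , same-order) s t s<t a≤fs ft≤b zs<zt
    | inj₂ (refl , refl) with toℕ (f (# 2)) <? a
  ...   | yes f₂<a = <-asym z₄<z₂
          (ascent-top-above-left (f (# 3)) (f (# 4)) a≤fs (f-increasing _ _ <-decide) ft≤b zs<zt (f (# 2)) f₂<a)
    where z₄<z₂ = Equivalence.to (same-order (# 4) (# 2)) <-decide
  ...   | no f₂≮a = no-312-within (f (# 2)) (f (# 3)) (f (# 4)) (≮⇒≥ f₂≮a)
          (f-increasing _ _ <-decide) (f-increasing _ _ <-decide) ft≤b zs<zt z₄<z₂
    where z₄<z₂ = Equivalence.to (same-order (# 4) (# 2)) <-decide

reflections-compose : ∀ {s v p c d} → s + suc v ≡ c → v + suc p ≡ d → s + d ≡ p + c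
reflections-compose {s} {v} {p} {c} {d} s+v+1≡c v+p+1≡d = begin
  s + d                 ≡⟨ cong (s +_) (sym v+p+1≡d) ⟩
  s + (v + suc p)       ≡⟨ solve 3 (λ s v p → s :+ (v :+ (con 1 :+ p)) := p :+ (s :+ (con 1 :+ v))) refl s v p ⟩
  p + (s + suc v)       ≡⟨ cong (p +_) s+v+1≡c ⟩
  p + c                 ∎
  where open ≡-Reasoning

translation-mono-< : ∀ {s p s′ p′ c d} → s + c ≡ p + d → s′ + c ≡ p′ + d → p < p′ → s < s′
translation-mono-< {s} {p} {s′} {p′} {c} {d} s+c≡p+d s′+c≡p′+d p<p′ = +-cancelʳ-≤ c (suc s) s′ (begin
  suc s + c   ≡⟨ cong suc s+c≡p+d ⟩
  suc p + d   ≤⟨ +-monoˡ-≤ d p<p′ ⟩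
  p′ + d      ≡⟨ sym s′+c≡p′+d ⟩
  s′ + c      ∎)
  where open ≤-Reasoning

reflection-anti-≤ : ∀ {s p s′ p′ c} → s + p ≡ c → s′ + p′ ≡ c → p ≤ p′ → s′ ≤ s
reflection-anti-≤ {s} {p} {s′} {p′} s+p≡c s′+p′≡c p≤p′ = +-cancelʳ-≤ p s′ s (begin
  s′ + p    ≤⟨ +-monoʳ-≤ s′ p≤p′ ⟩
  s′ + p′   ≡⟨ trans s′+p′≡c (sym s+p≡c) ⟩
  s + p     ∎)
  where open ≤-Reasoning

reflection-anti-< : ∀ {s p s′ p′ c} → s + p ≡ c → s′ + p′ ≡ c → p < p′ → s′ < s
reflection-anti-< {s} {p} {s′} {p′} s+p≡c s′+p′≡c p<p′ = +-cancelʳ-≤ p (suc s′) s (begin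
  suc s′ + p    ≡⟨ sym (+-suc s′ p) ⟩
  s′ + suc p    ≤⟨ +-monoʳ-≤ s′ p<p′ ⟩
  s′ + p′       ≡⟨ trans s′+p′≡c (sym s+p≡c) ⟩
  s + p         ∎)
  where open ≤-Reasoning

module MinimalCosetRepresentative {n} {x y : Perm n} {a b : ℕ} (b<n : b < n)
  (x-decreasing : DecreasingOn x a b) (y-min : IsMinCosetRep x (Jint a b) y) where

  u : Perm n
  u = proj₁ (proj₁ y-min)

  u∈W : InW (Jint a b) u
  u∈W = proj₁ (proj₂ (proj₁ y-min))

  y≡x∘u : ∀ p → y at p ≡ x at (u ⟨$⟩ʳ p)
  y≡x∘u p = cong toℕ (proj₂ (proj₂ (proj₁ y-min)) p)

  u-maps-into : ∀ p → a ≤ toℕ p → toℕ p ≤ b → a ≤ u at p × u at p ≤ b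
  u-maps-into p a≤p p≤b = InW-preserves (InInterval a b)
    (λ i (a≤i , i<b) _ → ≤-trans a≤i (n≤1+n i) , i<b)
    (λ i (a≤i , i<b) _ → a≤i , <⇒≤ i<b) u∈W p (a≤p , p≤b)

  u-fixes : ∀ p → ¬ InInterval a b (toℕ p) → u ⟨$⟩ʳ p ≡ p
  u-fixes = InW-fixes (InInterval a b) (λ i (a≤i , i<b) → (a≤i , <⇒≤ i<b) , (≤-trans a≤i (n≤1+n i) , i<b)) u∈W

  u-decreasing : ∀ i j → toℕ j ≡ suc (toℕ i) → a ≤ toℕ i → toℕ j < suc b → u at j < u at i
  u-decreasing i j adj a≤i j<b+1 = DecreasingOn-reflects-< {x = x} x-decreasing (u ⟨$⟩ʳ i) (u ⟨$⟩ʳ j)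
    (proj₁ ui) (proj₂ ui) (proj₁ uj) (proj₂ uj)
    (subst₂ _<_ (y≡x∘u i) (y≡x∘u j) (minCosetRep-ascent {x = x} {y = y} y-min i j adj (a≤i , i<b)))
    where
    i<b = subst (_≤ b) adj (≤-pred j<b+1)
    ui = u-maps-into i a≤i (<⇒≤ i<b)
    uj = u-maps-into j (≤-trans a≤i (≤-trans (n≤1+n _) (≤-reflexive (sym adj)))) (≤-pred j<b+1)

  u-reverses : ∀ k → a ≤ toℕ k → toℕ k ≤ b → u at k + suc (toℕ k) ≡ a + suc b
  u-reverses k a≤k k≤b = DecreasingSelfMap.reversal a (suc b) b<n (u at_)
    (λ k a≤k k≤b → let (a≤uk , uk≤b) = u-maps-into k a≤k (≤-pred k≤b) in a≤uk , s≤s uk≤b)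
    u-decreasing k a≤k (s≤s k≤b)

module LongestOfTwoBlocks {n} {w₀ : Perm n} {a b l r : ℕ} (b<n : b < n)
  (a≤l : a ≤ l) (l≤b : l ≤ b) (a≤r : a ≤ r) (r≤b : r ≤ b) (r≤l+1 : r ≤ suc l)
  (w₀-longest : IsLongest (Jstar a b l r) w₀) where

  -- The blocks of J* are [a, m₁) and (m₂, b]; W_{J*} fixes every position of [m₁, m₂].
  m₁ m₂ : ℕ
  m₁ = a + (b ∸ l)
  m₂ = (b ∸ r) + a

  InLeftBlock InRightBlock : ℕ → Set
  InLeftBlock  k = a ≤ k × suc k ≤ m₁
  InRightBlock k = suc m₂ ≤ k × k ≤ b

  m₁≤b : m₁ ≤ b
  m₁≤b = begin
    a + (b ∸ l)  ≤⟨ +-monoˡ-≤ (b ∸ l) a≤l ⟩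
    l + (b ∸ l)  ≡⟨ m+[n∸m]≡n l≤b ⟩
    b            ∎
    where open ≤-Reasoning

  m₂≤b : m₂ ≤ b
  m₂≤b = begin
    (b ∸ r) + a  ≤⟨ +-monoʳ-≤ (b ∸ r) a≤r ⟩
    (b ∸ r) + r  ≡⟨ m∸n+n≡m r≤b ⟩
    b            ∎
    where open ≤-Reasoning

  m₁≤m₂+1 : m₁ ≤ suc m₂
  m₁≤m₂+1 = begin
    a + (b ∸ l)       ≤⟨ +-monoʳ-≤ a b∸l≤b∸r+1 ⟩
    a + suc (b ∸ r)   ≡⟨ solve 2 (λ a d → a :+ (con 1 :+ d) := con 1 :+ (d :+ a)) refl a (b ∸ r) ⟩
    suc m₂            ∎
    where
    open ≤-Reasoning
    b∸l≤b∸r+1 : b ∸ l ≤ suc (b ∸ r)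
    b∸l≤b∸r+1 = +-cancelʳ-≤ l (b ∸ l) (suc (b ∸ r)) (begin
      b ∸ l + l         ≡⟨ m∸n+n≡m l≤b ⟩
      b                 ≡⟨ sym (m∸n+n≡m r≤b) ⟩
      b ∸ r + r         ≤⟨ +-monoʳ-≤ (b ∸ r) r≤l+1 ⟩
      b ∸ r + suc l     ≡⟨ +-suc (b ∸ r) l ⟩
      suc (b ∸ r) + l   ∎)

  blocks-disjoint : ∀ k → InLeftBlock k → ¬ InRightBlock k
  blocks-disjoint k (_ , k<m₁) (m₂<k , _) = <-irrefl refl (≤-trans (s≤s m₂<k) (≤-trans k<m₁ m₁≤m₂+1))

  left-block⊆interval : ∀ k → InLeftBlock k → InInterval a b k
  left-block⊆interval k (a≤k , k<m₁) = a≤k , ≤-trans (n≤1+n k) (≤-trans k<m₁ m₁≤b)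

  right-block⊆interval : ∀ k → InRightBlock k → InInterval a b k
  right-block⊆interval k (m₂<k , k≤b) = ≤-trans (m≤n+m a (b ∸ r)) (≤-trans (n≤1+n m₂) m₂<k) , k≤b

  generator-within-block : ∀ i → Jstar a b l r i →
    (InLeftBlock i × InLeftBlock (suc i)) ⊎ (InRightBlock i × InRightBlock (suc i))
  generator-within-block i (inj₁ (a≤i , i+1<m₁)) =
    inj₁ ((a≤i , ≤-trans (n≤1+n _) i+1<m₁) , (≤-trans a≤i (n≤1+n i) , i+1<m₁))
  generator-within-block i (inj₂ (m₂<i , i<b)) =
    inj₂ ((m₂<i , <⇒≤ i<b) , (≤-trans m₂<i (n≤1+n i) , i<b))

  private
    v : Perm n
    v = proj₁ (proj₁ w₀-longest)

    v∈W : InW (Jstar a b l r) v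
    v∈W = proj₁ (proj₂ (proj₁ w₀-longest))

    w₀≡v : ∀ p → w₀ ⟨$⟩ʳ p ≡ v ⟨$⟩ʳ p
    w₀≡v = proj₂ (proj₂ (proj₁ w₀-longest))

  w₀-preserves : (R : ℕ → Set) → (∀ i → Jstar a b l r i → (R i → R (suc i)) × (R (suc i) → R i)) →
    ∀ p → R (toℕ p) → R (w₀ at p)
  w₀-preserves R closed p Rp = subst R (sym (cong toℕ (w₀≡v p)))
    (InW-preserves R (λ i K → proj₁ (closed i K)) (λ i K → proj₂ (closed i K)) v∈W p Rp)

  w₀-preserves-left-block : ∀ p → InLeftBlock (toℕ p) → InLeftBlock (w₀ at p)
  w₀-preserves-left-block = w₀-preserves InLeftBlock λ i K → case generator-within-block i K of λ where
    (inj₁ (left , left′))   → (λ _ → left′) , (λ _ → left)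
    (inj₂ (right , right′)) → (λ left → ⊥-elim (blocks-disjoint i left right))
                            , (λ left′ → ⊥-elim (blocks-disjoint (suc i) left′ right′))

  w₀-preserves-right-block : ∀ p → InRightBlock (toℕ p) → InRightBlock (w₀ at p)
  w₀-preserves-right-block = w₀-preserves InRightBlock λ i K → case generator-within-block i K of λ where
    (inj₁ (left , left′))   → (λ right → ⊥-elim (blocks-disjoint i left right))
                            , (λ right′ → ⊥-elim (blocks-disjoint (suc i) left′ right′))
    (inj₂ (right , right′)) → (λ _ → right′) , (λ _ → right)

  w₀-preserves-interval : ∀ p → InInterval a b (toℕ p) → InInterval a b (w₀ at p)
  w₀-preserves-interval = w₀-preserves (InInterval a b) λ i K → case generator-within-block i K of λ where
    (inj₁ (left , left′))   → (λ _ → left-block⊆interval _ left′) , (λ _ → left-block⊆interval _ left)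
    (inj₂ (right , right′)) → (λ _ → right-block⊆interval _ right′) , (λ _ → right-block⊆interval _ right)

  w₀-fixes-off-blocks : ∀ p → ¬ InLeftBlock (toℕ p) → ¬ InRightBlock (toℕ p) → w₀ ⟨$⟩ʳ p ≡ p
  w₀-fixes-off-blocks p ∉left ∉right = trans (w₀≡v p)
    (InW-fixes (λ k → InLeftBlock k ⊎ InRightBlock k) supported v∈W p λ where
      (inj₁ left)  → ∉left left
      (inj₂ right) → ∉right right)
    where
    supported : ∀ i → Jstar a b l r i → (InLeftBlock i ⊎ InRightBlock i) × (InLeftBlock (suc i) ⊎ InRightBlock (suc i))
    supported i K with generator-within-block i K
    ... | inj₁ (left , left′)   = inj₁ left , inj₁ left′
    ... | inj₂ (right , right′) = inj₂ right , inj₂ right′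

  w₀-fixes : ∀ p → ¬ InInterval a b (toℕ p) → w₀ ⟨$⟩ʳ p ≡ p
  w₀-fixes p p∉[a,b] = w₀-fixes-off-blocks p (p∉[a,b] ∘ left-block⊆interval _) (p∉[a,b] ∘ right-block⊆interval _)

  w₀-reverses-left-block : ∀ k → InLeftBlock (toℕ k) → w₀ at k + suc (toℕ k) ≡ a + m₁
  w₀-reverses-left-block k (a≤k , k<m₁) = DecreasingSelfMap.reversal a m₁ (≤-trans m₁≤b (<⇒≤ b<n)) (w₀ at_)
    (λ k a≤k k<m₁ → w₀-preserves-left-block k (a≤k , k<m₁))
    (λ i j adj a≤i j<m₁ → longest-descent {w₀ = w₀} w₀-longest i j adj (inj₁ (a≤i , subst (_< m₁) adj j<m₁)))
    k a≤k k<m₁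

  w₀-reverses-right-block : ∀ k → InRightBlock (toℕ k) → w₀ at k + suc (toℕ k) ≡ suc m₂ + suc b
  w₀-reverses-right-block k (m₂<k , k≤b) = DecreasingSelfMap.reversal (suc m₂) (suc b) b<n (w₀ at_)
    (λ k m₂<k k<b+1 → let (m₂<w₀k , w₀k≤b) = w₀-preserves-right-block k (m₂<k , ≤-pred k<b+1)
                      in m₂<w₀k , s≤s w₀k≤b)
    (λ i j adj m₂<i j<b+1 → longest-descent {w₀ = w₀} w₀-longest i j adj
                              (inj₂ (m₂<i , subst (_≤ b) adj (≤-pred j<b+1))))
    k m₂<k (s≤s k≤b)

module StrongDescentRearrangement {n} (x : Perm n) (a b : Fin n)
  (x-avoids-4231 : Avoids x p4231) (x-avoids-45312 : Avoids x p45312) (descent : StrongRightDescent x a b)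
  (y : Perm n) (y-min : IsMinCosetRep x (Jint (toℕ a) (toℕ b)) y)
  (l r : Fin n) (a≤l : toℕ a ≤ toℕ l) (l≤b : toℕ l ≤ toℕ b) (a≤r : toℕ a ≤ toℕ r) (r≤b : toℕ r ≤ toℕ b)
  (left-directed : ∀ p → toℕ a ≤ toℕ p → toℕ p ≤ toℕ b → LeftDirected x a b p ⇔ toℕ p ≤ toℕ l)
  (right-directed : ∀ p → toℕ a ≤ toℕ p → toℕ p ≤ toℕ b → RightDirected x a b p ⇔ toℕ r ≤ toℕ p)
  (w₀ : Perm n) (w₀-longest : IsLongest (Jstar (toℕ a) (toℕ b) (toℕ l) (toℕ r)) w₀) where

  A B L R : ℕ
  A = toℕ a
  B = toℕ b
  L = toℕ l
  R = toℕ r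

  x-decreasing : DecreasingOn x A B
  x-decreasing = proj₁ descent

  b<n : B < n
  b<n = toℕ<n b

  -- Otherwise l+1 is neither left- nor right-directed, and the witnesses q < a and q′ > b
  -- of this give the occurrence q a (l+1) b q′ of 45312 in x.
  r≤l+1 : R ≤ suc L
  r≤l+1 with R ≤? suc L
  ... | yes r≤l+1 = r≤l+1
  ... | no r≰l+1 = ⊥-elim (x-avoids-45312 (realizes-45312 x q a p b q′ q<a a<p p<b b<q′ xb<xq′ xq′<xp xp<xq xq<xa))
    where
    l+2≤r : suc (suc L) ≤ R
    l+2≤r = ≰⇒> r≰l+1
    p : Fin n
    p = fromℕ< (<-trans (≤-trans l+2≤r r≤b) b<n)
    p≡l+1 : toℕ p ≡ suc L
    p≡l+1 = toℕ-fromℕ< _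
    a<p : A < toℕ p
    a<p = subst (A <_) (sym p≡l+1) (s≤s a≤l)
    p<b : toℕ p < B
    p<b = subst (_< B) (sym p≡l+1) (≤-trans l+2≤r r≤b)
    not-left-directed : ¬ LeftDirected x a b p
    not-left-directed ld = <-irrefl p≡l+1 (s≤s (Equivalence.to (left-directed p (<⇒≤ a<p) (<⇒≤ p<b)) ld))
    not-right-directed : ¬ RightDirected x a b p
    not-right-directed rd = <⇒≱ l+2≤r (subst (R ≤_) p≡l+1 (Equivalence.to (right-directed p (<⇒≤ a<p) (<⇒≤ p<b)) rd))
    left-violation = ∃-violation (λ q → toℕ q <? A) (λ q → x at q <? x at p) not-left-directed
    right-violation = ∃-violation (λ q → B <? toℕ q) (λ q → x at p <? x at q) not-right-directed
    q q′ : Fin n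
    q = proj₁ left-violation
    q′ = proj₁ right-violation
    q<a : toℕ q < A
    q<a = proj₁ (proj₂ left-violation)
    b<q′ : B < toℕ q′
    b<q′ = proj₁ (proj₂ right-violation)
    xq<xa : x at q < x at a
    xq<xa = at-≤⇒< x (<⇒≢ q<a) (proj₂ (proj₁ (proj₂ descent)) q (<⇒≤ q<a))
    xp<xq : x at p < x at q
    xp<xq = at-≤⇒< x (≢-sym (<⇒≢ (<-trans q<a a<p))) (≮⇒≥ (proj₂ (proj₂ left-violation)))
    xq′<xp : x at q′ < x at p
    xq′<xp = at-≤⇒< x (≢-sym (<⇒≢ (<-trans p<b b<q′))) (≮⇒≥ (proj₂ (proj₂ right-violation)))
    xb<xq′ : x at b < x at q′
    xb<xq′ = at-≤⇒< x (<⇒≢ b<q′) (proj₂ (proj₂ (proj₂ descent)) q′ (<⇒≤ b<q′))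

  open MinimalCosetRepresentative {x = x} {y = y} b<n x-decreasing y-min
  open LongestOfTwoBlocks {w₀ = w₀} b<n a≤l l≤b a≤r r≤b r≤l+1 w₀-longest

  σ : Fin n → Fin n
  σ p = u ⟨$⟩ʳ (w₀ ⟨$⟩ʳ p)

  S : Fin n → ℕ
  S p = toℕ (σ p)

  z : Perm n
  z = y · w₀

  z≡x∘σ : ∀ p → z at p ≡ x at σ p
  z≡x∘σ p = y≡x∘u (w₀ ⟨$⟩ʳ p)

  σ-fixes : ∀ p → ¬ InInterval A B (toℕ p) → σ p ≡ p
  σ-fixes p p∉[a,b] = trans (cong (u ⟨$⟩ʳ_) (w₀-fixes p p∉[a,b])) (u-fixes p p∉[a,b])

  σ-maps-into : ∀ p → A ≤ toℕ p → toℕ p ≤ B → A ≤ S p × S p ≤ B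
  σ-maps-into p a≤p p≤b = u-maps-into (w₀ ⟨$⟩ʳ p) (proj₁ w₀p∈[a,b]) (proj₂ w₀p∈[a,b])
    where w₀p∈[a,b] = w₀-preserves-interval p (a≤p , p≤b)

  σ-on-left-block : ∀ p → InLeftBlock (toℕ p) → S p + A ≡ toℕ p + suc L
  σ-on-left-block p p∈left = +-cancelʳ-≡ m₁ (S p + A) (toℕ p + suc L) (begin
    S p + A + m₁                      ≡⟨ +-assoc (S p) A m₁ ⟩
    S p + (A + m₁)                    ≡⟨ reflections-compose (u-reverses (w₀ ⟨$⟩ʳ p) (proj₁ w₀p∈left) w₀p≤b)
                                                             (w₀-reverses-left-block p p∈left) ⟩
    toℕ p + (A + suc B)               ≡⟨ cong (λ t → toℕ p + (A + suc t)) (sym (m∸n+n≡m l≤b)) ⟩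
    toℕ p + (A + suc (B ∸ L + L))     ≡⟨ solve 4 (λ p a d l → p :+ (a :+ (con 1 :+ (d :+ l)))
                                                        := (p :+ (con 1 :+ l)) :+ (a :+ d)) refl (toℕ p) A (B ∸ L) L ⟩
    toℕ p + suc L + m₁                ∎)
    where
    open ≡-Reasoning
    w₀p∈left = w₀-preserves-left-block p p∈left
    w₀p≤b = ≤-trans (n≤1+n _) (≤-trans (proj₂ w₀p∈left) m₁≤b)

  σ-on-middle : ∀ p → m₁ ≤ toℕ p → toℕ p ≤ m₂ → S p + toℕ p ≡ A + B
  σ-on-middle p m₁≤p p≤m₂ = suc-injective (begin
    suc (S p + toℕ p)   ≡⟨ sym (+-suc (S p) (toℕ p)) ⟩
    S p + suc (toℕ p)   ≡⟨ cong (λ k → toℕ (u ⟨$⟩ʳ k) + suc (toℕ p)) w₀p≡p ⟩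
    u at p + suc (toℕ p) ≡⟨ u-reverses p (≤-trans (m≤m+n A (B ∸ L)) m₁≤p) (≤-trans p≤m₂ m₂≤b) ⟩
    A + suc B           ≡⟨ +-suc A B ⟩
    suc (A + B)         ∎)
    where
    open ≡-Reasoning
    w₀p≡p : w₀ ⟨$⟩ʳ p ≡ p
    w₀p≡p = w₀-fixes-off-blocks p (λ (_ , p<m₁) → <⇒≱ p<m₁ m₁≤p) (λ (m₂<p , _) → <⇒≱ m₂<p p≤m₂)

  σ-on-right-block : ∀ p → InRightBlock (toℕ p) → S p + suc B ≡ toℕ p + R
  σ-on-right-block p p∈right = +-cancelʳ-≡ (suc m₂) (S p + suc B) (toℕ p + R) (begin
    S p + suc B + suc m₂              ≡⟨ solve 3 (λ s b m → s :+ (con 1 :+ b) :+ (con 1 :+ m)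
                                                        := s :+ ((con 1 :+ m) :+ (con 1 :+ b))) refl (S p) B m₂ ⟩
    S p + (suc m₂ + suc B)            ≡⟨ reflections-compose (u-reverses (w₀ ⟨$⟩ʳ p) a≤w₀p (proj₂ w₀p∈right))
                                                             (w₀-reverses-right-block p p∈right) ⟩
    toℕ p + (A + suc B)               ≡⟨ cong (λ t → toℕ p + (A + suc t)) (sym (m∸n+n≡m r≤b)) ⟩
    toℕ p + (A + suc (B ∸ R + R))     ≡⟨ solve 4 (λ p a d r → p :+ (a :+ (con 1 :+ (d :+ r)))
                                                        := (p :+ r) :+ (con 1 :+ (d :+ a))) refl (toℕ p) A (B ∸ R) R ⟩
    toℕ p + R + suc m₂                ∎)
    where
    open ≡-Reasoning
    w₀p∈right = w₀-preserves-right-block p p∈right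
    a≤w₀p = ≤-trans (m≤n+m A (B ∸ R)) (≤-trans (n≤1+n _) (proj₁ w₀p∈right))

  data Region (k : ℕ) : Set where
    left-block  : InLeftBlock k → Region k
    middle      : m₁ ≤ k → k ≤ m₂ → Region k
    right-block : InRightBlock k → Region k

  region : ∀ k → A ≤ k → k ≤ B → Region k
  region k a≤k k≤b with suc k ≤? m₁ | suc m₂ ≤? k
  ... | yes k<m₁ | _        = left-block (a≤k , k<m₁)
  ... | no _     | yes m₂<k = right-block (m₂<k , k≤b)
  ... | no k≮m₁  | no m₂≮k  = middle (≤-pred (≰⇒> k≮m₁)) (≤-pred (≰⇒> m₂≮k))

  σ-left-block-above-l : ∀ p → InLeftBlock (toℕ p) → L < S p
  σ-left-block-above-l p p∈left = +-cancelʳ-≤ A (suc L) (S p) (begin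
    suc L + A       ≤⟨ +-monoʳ-≤ (suc L) (proj₁ p∈left) ⟩
    suc L + toℕ p   ≡⟨ +-comm (suc L) (toℕ p) ⟩
    toℕ p + suc L   ≡⟨ sym (σ-on-left-block p p∈left) ⟩
    S p + A         ∎)
    where open ≤-Reasoning

  σ-middle-below-l : ∀ p → m₁ ≤ toℕ p → toℕ p ≤ m₂ → S p ≤ L
  σ-middle-below-l p m₁≤p p≤m₂ = +-cancelʳ-≤ (toℕ p) (S p) L (begin
    S p + toℕ p     ≡⟨ σ-on-middle p m₁≤p p≤m₂ ⟩
    A + B           ≡⟨ cong (A +_) (sym (m∸n+n≡m l≤b)) ⟩
    A + (B ∸ L + L) ≡⟨ solve 3 (λ a d l → a :+ (d :+ l) := l :+ (a :+ d)) refl A (B ∸ L) L ⟩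
    L + m₁          ≤⟨ +-monoʳ-≤ L m₁≤p ⟩
    L + toℕ p       ∎)
    where open ≤-Reasoning

  σ-middle-above-r : ∀ p → m₁ ≤ toℕ p → toℕ p ≤ m₂ → R ≤ S p
  σ-middle-above-r p m₁≤p p≤m₂ = +-cancelʳ-≤ (toℕ p) R (S p) (begin
    R + toℕ p       ≤⟨ +-monoʳ-≤ R p≤m₂ ⟩
    R + m₂          ≡⟨ solve 3 (λ r d a → r :+ (d :+ a) := a :+ (d :+ r)) refl R (B ∸ R) A ⟩
    A + (B ∸ R + R) ≡⟨ cong (A +_) (m∸n+n≡m r≤b) ⟩
    A + B           ≡⟨ sym (σ-on-middle p m₁≤p p≤m₂) ⟩
    S p + toℕ p     ∎)
    where open ≤-Reasoning

  σ-right-block-below-r : ∀ p → InRightBlock (toℕ p) → S p < R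
  σ-right-block-below-r p p∈right = +-cancelʳ-≤ B (suc (S p)) R (begin
    suc (S p) + B   ≡⟨ sym (+-suc (S p) B) ⟩
    S p + suc B     ≡⟨ σ-on-right-block p p∈right ⟩
    toℕ p + R       ≤⟨ +-monoˡ-≤ R (proj₂ p∈right) ⟩
    B + R           ≡⟨ +-comm B R ⟩
    R + B           ∎)
    where open ≤-Reasoning

  σ-below-l-off-left-block : ∀ p → A ≤ toℕ p → toℕ p ≤ B → ¬ InLeftBlock (toℕ p) → S p ≤ L
  σ-below-l-off-left-block p a≤p p≤b ∉left with region (toℕ p) a≤p p≤b
  ... | left-block p∈left   = ⊥-elim (∉left p∈left)
  ... | middle m₁≤p p≤m₂    = σ-middle-below-l p m₁≤p p≤m₂
  ... | right-block p∈right = ≤-pred (≤-trans (σ-right-block-below-r p p∈right) r≤l+1)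

  σ-above-r-off-right-block : ∀ p → A ≤ toℕ p → toℕ p ≤ B → ¬ InRightBlock (toℕ p) → R ≤ S p
  σ-above-r-off-right-block p a≤p p≤b ∉right with region (toℕ p) a≤p p≤b
  ... | left-block p∈left   = ≤-trans r≤l+1 (σ-left-block-above-l p p∈left)
  ... | middle m₁≤p p≤m₂    = σ-middle-above-r p m₁≤p p≤m₂
  ... | right-block p∈right = ⊥-elim (∉right p∈right)

  σ-increasing-on-left-block : ∀ p q → InLeftBlock (toℕ p) → InLeftBlock (toℕ q) → toℕ p < toℕ q → S p < S q
  σ-increasing-on-left-block p q p∈left q∈left =
    translation-mono-< (σ-on-left-block p p∈left) (σ-on-left-block q q∈left)

  σ-increasing-on-right-block : ∀ p q → InRightBlock (toℕ p) → InRightBlock (toℕ q) → toℕ p < toℕ q → S p < S q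
  σ-increasing-on-right-block p q p∈right q∈right =
    translation-mono-< (σ-on-right-block p p∈right) (σ-on-right-block q q∈right)

  σ-ascent⇒increasing-between : ∀ e₁ e₃ → A ≤ toℕ e₁ → toℕ e₁ < toℕ e₃ → toℕ e₃ ≤ B → S e₁ < S e₃ →
    ∀ e e′ → toℕ e₁ ≤ toℕ e → toℕ e < toℕ e′ → toℕ e′ ≤ toℕ e₃ → S e < S e′
  σ-ascent⇒increasing-between e₁ e₃ a≤e₁ e₁<e₃ e₃≤b S₁<S₃ e e′ e₁≤e e<e′ e′≤e₃ =
    by-regions (region (toℕ e₃) a≤e₃ e₃≤b) (region (toℕ e₁) a≤e₁ e₁≤b)
    where
    a≤e₃ = ≤-trans a≤e₁ (<⇒≤ e₁<e₃)
    e₁≤b = ≤-trans (<⇒≤ e₁<e₃) e₃≤b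
    a≤e = ≤-trans a≤e₁ e₁≤e
    e′≤b = ≤-trans e′≤e₃ e₃≤b
    by-regions : Region (toℕ e₃) → Region (toℕ e₁) → S e < S e′
    by-regions (left-block (_ , e₃<m₁)) _ = σ-increasing-on-left-block e e′
      (a≤e , ≤-trans (s≤s (<⇒≤ (<-≤-trans e<e′ e′≤e₃))) e₃<m₁)
      (≤-trans a≤e (<⇒≤ e<e′) , ≤-trans (s≤s e′≤e₃) e₃<m₁) e<e′
    by-regions _ (right-block (m₂<e₁ , _)) = σ-increasing-on-right-block e e′
      (≤-trans m₂<e₁ e₁≤e , ≤-trans (<⇒≤ e<e′) e′≤b)
      (≤-trans m₂<e₁ (≤-trans e₁≤e (<⇒≤ e<e′)) , e′≤b) e<e′
    by-regions (middle m₁≤e₃ e₃≤m₂) (left-block e₁∈left) =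
      ⊥-elim (<-asym S₁<S₃ (≤-<-trans (σ-middle-below-l e₃ m₁≤e₃ e₃≤m₂) (σ-left-block-above-l e₁ e₁∈left)))
    by-regions (right-block e₃∈right) (left-block e₁∈left) =
      ⊥-elim (<-asym S₁<S₃ (<-≤-trans (σ-right-block-below-r e₃ e₃∈right)
                                     (≤-trans r≤l+1 (σ-left-block-above-l e₁ e₁∈left))))
    by-regions (middle m₁≤e₃ e₃≤m₂) (middle m₁≤e₁ e₁≤m₂) =
      ⊥-elim (<-asym S₁<S₃ (reflection-anti-< (σ-on-middle e₁ m₁≤e₁ e₁≤m₂) (σ-on-middle e₃ m₁≤e₃ e₃≤m₂) e₁<e₃))
    by-regions (right-block e₃∈right) (middle m₁≤e₁ e₁≤m₂) =
      ⊥-elim (<-asym S₁<S₃ (<-≤-trans (σ-right-block-below-r e₃ e₃∈right) (σ-middle-above-r e₁ m₁≤e₁ e₁≤m₂)))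

  z-outside : ∀ q → ¬ InInterval A B (toℕ q) → z at q ≡ x at q
  z-outside q q∉[a,b] = trans (z≡x∘σ q) (cong (x at_) (σ-fixes q q∉[a,b]))

  z-ascent⇒σ-descent : ∀ p q → A ≤ toℕ p → toℕ p ≤ B → A ≤ toℕ q → toℕ q ≤ B → z at p < z at q → S q < S p
  z-ascent⇒σ-descent p q a≤p p≤b a≤q q≤b zp<zq =
    DecreasingOn-reflects-< {x = x} x-decreasing (σ p) (σ q) (proj₁ σp∈) (proj₂ σp∈) (proj₁ σq∈) (proj₂ σq∈)
      (subst₂ _<_ (z≡x∘σ p) (z≡x∘σ q) zp<zq)
    where
    σp∈ = σ-maps-into p a≤p p≤b
    σq∈ = σ-maps-into q a≤q q≤b

  σ-descent⇒z-ascent : ∀ p q → A ≤ toℕ p → toℕ p ≤ B → A ≤ toℕ q → toℕ q ≤ B → S q < S p → z at p < z at q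
  σ-descent⇒z-ascent p q a≤p p≤b a≤q q≤b Sq<Sp = subst₂ _<_ (sym (z≡x∘σ p)) (sym (z≡x∘σ q))
    (x-decreasing (σ q) (σ p) (proj₁ (σ-maps-into q a≤q q≤b)) Sq<Sp (proj₂ (σ-maps-into p a≤p p≤b)))

  σ-≤⇒z-≥ : ∀ p q → A ≤ toℕ p → toℕ p ≤ B → A ≤ toℕ q → toℕ q ≤ B → S q ≤ S p → z at p ≤ z at q
  σ-≤⇒z-≥ p q a≤p p≤b a≤q q≤b Sq≤Sp with m≤n⇒m<n∨m≡n Sq≤Sp
  ... | inj₁ Sq<Sp = <⇒≤ (σ-descent⇒z-ascent p q a≤p p≤b a≤q q≤b Sq<Sp)
  ... | inj₂ Sq≡Sp = ≤-reflexive (trans (z≡x∘σ p) (trans (cong (x at_) (toℕ-injective (sym Sq≡Sp))) (sym (z≡x∘σ q))))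

  ascent-top-above-left : ∀ e e′ → A ≤ toℕ e → toℕ e < toℕ e′ → toℕ e′ ≤ B → z at e < z at e′ →
    ∀ q → toℕ q < A → z at q < z at e′
  ascent-top-above-left e e′ a≤e e<e′ e′≤b ze<ze′ q q<a =
    subst₂ _<_ (sym (z-outside q (∉-left q<a))) (sym (z≡x∘σ e′))
      (Equivalence.from (left-directed (σ e′) (proj₁ σe′∈) (proj₂ σe′∈)) Se′≤l q q<a)
    where
    a≤e′ = ≤-trans a≤e (<⇒≤ e<e′)
    e≤b = ≤-trans (<⇒≤ e<e′) e′≤b
    σe′∈ = σ-maps-into e′ a≤e′ e′≤b
    Se′≤l : S e′ ≤ L
    Se′≤l = σ-below-l-off-left-block e′ a≤e′ e′≤b λ e′∈left →
      <-asym (z-ascent⇒σ-descent e e′ a≤e e≤b a≤e′ e′≤b ze<ze′)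
             (σ-increasing-on-left-block e e′ (a≤e , ≤-trans (s≤s (<⇒≤ e<e′)) (proj₂ e′∈left)) e′∈left e<e′)

  ascent-bottom-below-right : ∀ e e′ → A ≤ toℕ e → toℕ e < toℕ e′ → toℕ e′ ≤ B → z at e < z at e′ →
    ∀ q → B < toℕ q → z at e < z at q
  ascent-bottom-below-right e e′ a≤e e<e′ e′≤b ze<ze′ q b<q =
    subst₂ _<_ (sym (z≡x∘σ e)) (sym (z-outside q (∉-right b<q)))
      (Equivalence.from (right-directed (σ e) (proj₁ σe∈) (proj₂ σe∈)) r≤Se q b<q)
    where
    a≤e′ = ≤-trans a≤e (<⇒≤ e<e′)
    e≤b = ≤-trans (<⇒≤ e<e′) e′≤b
    σe∈ = σ-maps-into e a≤e e≤b
    r≤Se : R ≤ S e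
    r≤Se = σ-above-r-off-right-block e a≤e e≤b λ e∈right →
      <-asym (z-ascent⇒σ-descent e e′ a≤e e≤b a≤e′ e′≤b ze<ze′)
             (σ-increasing-on-right-block e e′ e∈right (≤-trans (proj₁ e∈right) (<⇒≤ e<e′) , e′≤b) e<e′)

  no-312-within : ∀ e₁ e₂ e₃ → A ≤ toℕ e₁ → toℕ e₁ < toℕ e₂ → toℕ e₂ < toℕ e₃ → toℕ e₃ ≤ B →
    z at e₂ < z at e₃ → ¬ (z at e₃ < z at e₁)
  no-312-within e₁ e₂ e₃ a≤e₁ e₁<e₂ e₂<e₃ e₃≤b z₂<z₃ z₃<z₁ =
    <-asym z₂<z₃ (σ-descent⇒z-ascent e₃ e₂ a≤e₃ e₃≤b a≤e₂ e₂≤b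
      (σ-ascent⇒increasing-between e₁ e₃ a≤e₁ e₁<e₃ e₃≤b S₁<S₃ e₂ e₃ (<⇒≤ e₁<e₂) e₂<e₃ ≤-refl))
    where
    e₁<e₃ = <-trans e₁<e₂ e₂<e₃
    a≤e₂ = ≤-trans a≤e₁ (<⇒≤ e₁<e₂)
    a≤e₃ = ≤-trans a≤e₂ (<⇒≤ e₂<e₃)
    e₂≤b = ≤-trans (<⇒≤ e₂<e₃) e₃≤b
    S₁<S₃ = z-ascent⇒σ-descent e₃ e₁ a≤e₃ e₃≤b a≤e₁ (≤-trans (<⇒≤ e₁<e₃) e₃≤b) z₃<z₁

  no-231-within : ∀ e₁ e₂ e₃ → A ≤ toℕ e₁ → toℕ e₁ < toℕ e₂ → toℕ e₂ < toℕ e₃ → toℕ e₃ ≤ B →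
    z at e₃ < z at e₁ → ¬ (z at e₁ < z at e₂)
  no-231-within e₁ e₂ e₃ a≤e₁ e₁<e₂ e₂<e₃ e₃≤b z₃<z₁ z₁<z₂ =
    <-asym z₁<z₂ (σ-descent⇒z-ascent e₂ e₁ a≤e₂ e₂≤b a≤e₁ e₁≤b
      (σ-ascent⇒increasing-between e₁ e₃ a≤e₁ e₁<e₃ e₃≤b S₁<S₃ e₁ e₂ ≤-refl e₁<e₂ (<⇒≤ e₂<e₃)))
    where
    e₁<e₃ = <-trans e₁<e₂ e₂<e₃
    a≤e₂ = ≤-trans a≤e₁ (<⇒≤ e₁<e₂)
    a≤e₃ = ≤-trans a≤e₂ (<⇒≤ e₂<e₃)
    e₂≤b = ≤-trans (<⇒≤ e₂<e₃) e₃≤b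
    e₁≤b = ≤-trans (<⇒≤ e₁<e₃) e₃≤b
    S₁<S₃ = z-ascent⇒σ-descent e₃ e₁ a≤e₃ e₃≤b a≤e₁ e₁≤b z₃<z₁

  uncrossed-in-middle : ∀ p → m₁ ≤ toℕ p → toℕ p ≤ m₂ → Uncrossed z p
  uncrossed-in-middle p m₁≤p p≤m₂ = (≤-refl , weakly-below) , (≤-refl , weakly-above)
    where
    a≤p = ≤-trans (m≤m+n A (B ∸ L)) m₁≤p
    p≤b = ≤-trans p≤m₂ m₂≤b
    σp∈ = σ-maps-into p a≤p p≤b
    Sp≤l = σ-middle-below-l p m₁≤p p≤m₂
    r≤Sp = σ-middle-above-r p m₁≤p p≤m₂
    weakly-below : ∀ q → toℕ q ≤ toℕ p → z at q ≤ z at p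
    weakly-below q q≤p with toℕ q <? A
    ... | yes q<a = <⇒≤ (subst₂ _<_ (sym (z-outside q (∉-left q<a))) (sym (z≡x∘σ p))
                      (Equivalence.from (left-directed (σ p) (proj₁ σp∈) (proj₂ σp∈)) Sp≤l q q<a))
    ... | no q≮a with region (toℕ q) (≮⇒≥ q≮a) (≤-trans q≤p p≤b)
    ...   | left-block q∈left = <⇒≤ (σ-descent⇒z-ascent q p (≮⇒≥ q≮a) (≤-trans q≤p p≤b) a≤p p≤b
                                     (≤-<-trans Sp≤l (σ-left-block-above-l q q∈left)))
    ...   | middle m₁≤q q≤m₂ = σ-≤⇒z-≥ q p (≮⇒≥ q≮a) (≤-trans q≤p p≤b) a≤p p≤b
                                 (reflection-anti-≤ (σ-on-middle q m₁≤q q≤m₂) (σ-on-middle p m₁≤p p≤m₂) q≤p)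
    ...   | right-block (m₂<q , _) = ⊥-elim (<⇒≱ m₂<q (≤-trans q≤p p≤m₂))
    weakly-above : ∀ q → toℕ p ≤ toℕ q → z at p ≤ z at q
    weakly-above q p≤q with B <? toℕ q
    ... | yes b<q = <⇒≤ (subst₂ _<_ (sym (z≡x∘σ p)) (sym (z-outside q (∉-right b<q)))
                      (Equivalence.from (right-directed (σ p) (proj₁ σp∈) (proj₂ σp∈)) r≤Sp q b<q))
    ... | no b≮q with region (toℕ q) (≤-trans a≤p p≤q) (≮⇒≥ b≮q)
    ...   | left-block (_ , q<m₁) = ⊥-elim (<⇒≱ q<m₁ (≤-trans m₁≤p p≤q))
    ...   | middle m₁≤q q≤m₂ = σ-≤⇒z-≥ p q a≤p p≤b (≤-trans a≤p p≤q) (≮⇒≥ b≮q)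
                                 (reflection-anti-≤ (σ-on-middle p m₁≤p p≤m₂) (σ-on-middle q m₁≤q q≤m₂) p≤q)
    ...   | right-block q∈right = <⇒≤ (σ-descent⇒z-ascent p q a≤p p≤b (≤-trans a≤p p≤q) (≮⇒≥ b≮q)
                                       (<-≤-trans (σ-right-block-below-r q q∈right) r≤Sp))

  open Rearrangement x z σ A B z≡x∘σ σ-fixes σ-maps-into x-decreasing
  open OccurrencesAcrossInterval z A B ascent-top-above-left ascent-bottom-below-right no-312-within no-231-within

  z-avoids-4231 : Avoids z p4231
  z-avoids-4231 occ = x-avoids-4231 (realizes-transfer {π = p4231} occ (4231-no-ascent-within occ))

  z-avoids-45312 : Avoids z p45312
  z-avoids-45312 occ = x-avoids-45312 (realizes-transfer {π = p45312} occ (45312-no-ascent-within occ))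

mainTheorem6 : ∀ (n : ℕ) (x : Perm n) (a b : Fin n) → toℕ a < toℕ b →
    Avoids x p4231 → Avoids x p45312 →
    StrongRightDescent x a b →
    ∀ (y : Perm n) → IsMinCosetRep x (Jint (toℕ a) (toℕ b)) y →
    ∀ (l r : Fin n) → toℕ a ≤ toℕ l → toℕ l ≤ toℕ b → toℕ a ≤ toℕ r → toℕ r ≤ toℕ b →
    (∀ (p : Fin n) → toℕ a ≤ toℕ p → toℕ p ≤ toℕ b → LeftDirected x a b p ⇔ toℕ p ≤ toℕ l) →
    (∀ (p : Fin n) → toℕ a ≤ toℕ p → toℕ p ≤ toℕ b → RightDirected x a b p ⇔ toℕ r ≤ toℕ p) →
    ∀ (w0 : Perm n) → IsLongest (Jstar (toℕ a) (toℕ b) (toℕ l) (toℕ r)) w0 →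
    Avoids (y · w0) p4231 × Avoids (y · w0) p45312 ×
    (∀ (p : Fin n) → toℕ a + (toℕ b ∸ toℕ l) ≤ toℕ p → toℕ p ≤ (toℕ b ∸ toℕ r) + toℕ a →
      Uncrossed (y · w0) p)
mainTheorem6 n x a b _ x-avoids-4231 x-avoids-45312 descent y y-min l r a≤l l≤b a≤r r≤b
  left-directed right-directed w₀ w₀-longest =
  z-avoids-4231 , z-avoids-45312 , uncrossed-in-middle
  where
  open StrongDescentRearrangement x a b x-avoids-4231 x-avoids-45312 descent y y-min l r a≤l l≤b a≤r r≤b
         left-directed right-directed w₀ w₀-longest
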